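{- If a Multiway Partitioning instance is feasible, i.e. there is a partition $A_1\dot\cup\cdots\dot\cup A_m=\{1,\dotsc,n\}$ with $\sum_{j\in A_i}p_j=T_i$ for all $i$, then there exists $a\in\{p_1,\dotsc,p_n\}$ such that mod-IP($a$) has a feasible solution.
   Context: A Multiway Partitioning instance consists of integers $n\ge m\ge1$, $p_1,\dotsc,p_n\in\mathbb{N}$ and $T_1,\dotsc,T_m\in\mathbb{N}$ with $p_1+\cdots+p_n=T_1+\cdots+T_m$. Let $p_{\max}=\max_j p_j$. A machine $i\in\{1,\dotsc,m\}$ is small if $T_i<p_{\max}^4$ and big otherwise; $S$ is the set of small machines and $B=\{1,\dotsc,m\}\setminus S$. For $a\in\{p_1,\dotsc,p_n\}$, mod-IP($a$) is the system in binary variables $x_{ij}\in\{0,1\}$ ($i=1,\dotsc,m$, $j=1,\dotsc,n$): $\sum_j p_jx_{ij}=T_i$ for all $i\in S$; $\sum_j p_jx_{ij}\equiv T_i \pmod a$ for all $i\in B$; $\sum_{j:p_j=a}\sum_{i\in B}x_{ij}\ge p_{\max}^2|B|$; $\sum_{i=1}^m x_{ij}=1$ for all $j=1,\dotsc,n$. -}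

module Defs where

open import Data.Nat using (ℕ; zero; suc; _+_; _*_; _^_; _<_; _≤_; _≥_; _⊔_)
open import Data.Fin using (Fin)
open import Data.Bool using (Bool; true; false; if_then_else_)
open import Data.Product using (Σ; _×_; ∃; ∃-syntax)
open import Relation.Binary.PropositionalEquality using (_≡_)
open import Data.Integer using (ℤ; +_; _-_)
import Data.Integer.Divisibility as ℤDiv
open import Relation.Nullary using (¬_; Dec)
import Relation.Nullary
open import Data.Nat using (_≟_)
import Data.Nat.Properties as ℕP
open import Relation.Nullary.Decidable using (⌊_⌋)

∑ : (n : ℕ) → (Fin n → ℕ) → ℕ
∑ zero f = 0
∑ (suc n) f = f Data.Fin.zero + ∑ n (λ j → f (Data.Fin.suc j))

pmax : (n : ℕ) → (Fin n → ℕ) → ℕ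
pmax zero f = 0
pmax (suc n) f = f Data.Fin.zero ⊔ pmax n (λ j → f (Data.Fin.suc j))

-- congruence x ≡ y (mod a) on ℕ: a divides x - y in ℤ (mod 0 means equality)
_≡_[mod_] : ℕ → ℕ → ℕ → Set
x ≡ y [mod a ] = (+ a) ℤDiv.∣ ((+ x) - (+ y))

b2n : Bool → ℕ
b2n true = 1
b2n false = 0

record MPInstance : Set where
  field
    n m   : ℕ
    1≤m   : 1 ≤ m
    m≤n   : m ≤ n
    p     : Fin n → ℕ
    T     : Fin m → ℕ
    total : ∑ n p ≡ ∑ m T

module _ (I : MPInstance) where
  open MPInstance I

  pm : ℕ
  pm = pmax n p

  Small : Fin m → Set
  Small i = T i < pm ^ 4

  Big : Fin m → Set
  Big i = ¬ Small i

  isBig : Fin m → ℕ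
  isBig i with ℕP._<?_ (T i) (pm ^ 4)
  ... | Relation.Nullary.yes _ = 0
  ... | Relation.Nullary.no _ = 1

  -- feasibility: a partition A_1 ∪ ... ∪ A_m of {1..n}, given by the
  -- assignment σ j = the unique i with j ∈ A_i
  Feasible : Set
  Feasible = Σ (Fin n → Fin m) λ σ →
    (i : Fin m) → ∑ n (λ j → if ⌊ i Data.Fin.≟ σ j ⌋ then p j else 0) ≡ T i

  ModIP : ℕ → (Fin m → Fin n → Bool) → Set
  ModIP a x =
      ((i : Fin m) → Small i → ∑ n (λ j → p j * b2n (x i j)) ≡ T i)
    × ((i : Fin m) → Big i → ∑ n (λ j → p j * b2n (x i j)) ≡ T i [mod a ])
    × (∑ n (λ j → if ⌊ p j ≟ a ⌋ then ∑ m (λ i → isBig i * b2n (x i j)) else 0)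
         ≥ pm ^ 2 * ∑ m isBig)
    × ((j : Fin n) → ∑ m (λ i → b2n (x i j)) ≡ 1)

  ModIPFeasible : ℕ → Set
  ModIPFeasible a = ∃[ x ] ModIP a x

-- Take x to be the given partition. It satisfies the equations of the small machines, the
-- congruences of the big machines for every modulus, and puts each job on exactly one machine,
-- so only the counting constraint depends on a. Every big machine has load at least pmax⁴, so the
-- jobs on big machines have total size at least pmax⁴|B|. Grouping them by size a ∈ {1, …, pmax},
-- if every size occurred fewer than pmax²|B| times there, that total would be less than
-- pmax · pmax · pmax²|B|. Hence some job size occurs at least pmax²|B| times on big machines.

{-# OPTIONS --safe #-}
module Submission where

open import Defs
open import Data.Bool using (Bool; true; false; if_then_else_)
open import Data.Fin using (Fin; zero; suc; toℕ; fromℕ<)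
import Data.Fin as Fin
open import Data.Fin.Properties using (toℕ<n; toℕ-fromℕ<; toℕ-injective; any?)
import Data.Integer as ℤ
open import Data.Integer.Properties using (i≡j⇒i-j≡0)
open import Data.Nat using (ℕ; zero; suc; _+_; _*_; _^_; _<_; _≤_; z≤n; s≤s; _≟_; _<?_; _≤?_)
open import Data.Nat.Divisibility using (_∣0)
open import Data.Integer.Divisibility using (_∣_)
open import Data.Nat.Properties
open import Data.Product using (∃-syntax; _,_; proj₁; proj₂)
open import Data.Vec.Functional using (Vector)
open import Function using (_∘_)
open import Function.Bundles using (_⇔_; mk⇔)
open import Relation.Binary.PropositionalEquality
open import Relation.Nullary using (Dec; yes; no; ¬_; contradiction)
open import Relation.Nullary.Decidable using (⌊_⌋; dec-false; does-⇔; ⌊⌋-map′; isYes≗does)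
import Algebra.Properties.Semiring.Sum +-*-semiring as Sum
open import Algebra.Properties.CommutativeSemigroup *-commutativeSemigroup using (x∙yz≈yx∙z)

∑≡sum : ∀ n (f : Vector ℕ n) → ∑ n f ≡ Sum.sum f
∑≡sum zero    f = refl
∑≡sum (suc n) f = cong (f zero +_) (∑≡sum n (λ j → f (suc j)))

∑-cong : ∀ n {f g : Fin n → ℕ} → (∀ j → f j ≡ g j) → ∑ n f ≡ ∑ n g
∑-cong zero    f≗g = refl
∑-cong (suc n) f≗g = cong₂ _+_ (f≗g zero) (∑-cong n (λ j → f≗g (suc j)))

∑-const : ∀ n c → ∑ n (λ _ → c) ≡ n * c
∑-const zero    c = refl
∑-const (suc n) c = cong (c +_) (∑-const n c)

∑-zero : ∀ n {f : Fin n → ℕ} → (∀ j → f j ≡ 0) → ∑ n f ≡ 0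
∑-zero n f≗0 = trans (∑-cong n f≗0) (trans (∑-const n 0) (*-zeroʳ n))

∑-mono-≤ : ∀ n {f g : Fin n → ℕ} → (∀ j → f j ≤ g j) → ∑ n f ≤ ∑ n g
∑-mono-≤ zero    f≤g = z≤n
∑-mono-≤ (suc n) f≤g = +-mono-≤ (f≤g zero) (∑-mono-≤ n (f≤g ∘ suc))

∑-mono-< : ∀ n {f g : Fin n → ℕ} → 0 < n → (∀ j → f j < g j) → ∑ n f < ∑ n g
∑-mono-< (suc n) _ f<g = +-mono-<-≤ (f<g zero) (∑-mono-≤ n (λ j → <⇒≤ (f<g (suc j))))

∑-comm : ∀ m n (f : Fin m → Fin n → ℕ) →
         ∑ m (λ i → ∑ n (f i)) ≡ ∑ n (λ j → ∑ m (λ i → f i j))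
∑-comm m n f = begin
  ∑ m (λ i → ∑ n (f i))                 ≡⟨ ∑-cong m (λ i → ∑≡sum n (f i)) ⟩
  ∑ m (λ i → Sum.sum (f i))             ≡⟨ ∑≡sum m _ ⟩
  Sum.sum (λ i → Sum.sum (f i))         ≡⟨ Sum.∑-comm f ⟩
  Sum.sum (λ j → Sum.sum (λ i → f i j)) ≡⟨ ∑≡sum n _ ⟨
  ∑ n (λ j → Sum.sum (λ i → f i j))     ≡⟨ ∑-cong n (λ j → ∑≡sum m (λ i → f i j)) ⟨
  ∑ n (λ j → ∑ m (λ i → f i j))         ∎
  where open ≡-Reasoning

*-distribˡ-∑ : ∀ n c (f : Fin n → ℕ) → c * ∑ n f ≡ ∑ n (λ j → c * f j)
*-distribˡ-∑ n c f = begin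
  c * ∑ n f                ≡⟨ cong (c *_) (∑≡sum n f) ⟩
  c * Sum.sum f            ≡⟨ Sum.*-distribˡ-sum c f ⟩
  Sum.sum (λ j → c * f j)  ≡⟨ ∑≡sum n _ ⟨
  ∑ n (λ j → c * f j)      ∎
  where open ≡-Reasoning

⌊⌋-⇔ : ∀ {a b} {A : Set a} {B : Set b} → A ⇔ B →
       (a? : Dec A) (b? : Dec B) → ⌊ a? ⌋ ≡ ⌊ b? ⌋
⌊⌋-⇔ A⇔B a? b? = trans (isYes≗does a?) (trans (does-⇔ A⇔B a? b?) (sym (isYes≗does b?)))

⌊⌋-false : ∀ {a} {A : Set a} (a? : Dec A) → ¬ A → ⌊ a? ⌋ ≡ false
⌊⌋-false a? ¬a = trans (isYes≗does a?) (dec-false a? ¬a)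

if-then-0≡*b2n : ∀ b y → (if b then y else 0) ≡ y * b2n b
if-then-0≡*b2n true  y = sym (*-identityʳ y)
if-then-0≡*b2n false y = sym (*-zeroʳ y)

∑-select : ∀ m (f : Fin m → ℕ) k → ∑ m (λ i → f i * b2n ⌊ i Fin.≟ k ⌋) ≡ f k
∑-select (suc m) f zero = begin
  f zero * 1 + ∑ m (λ i → f (suc i) * 0)
    ≡⟨ cong₂ _+_ (*-identityʳ (f zero)) (∑-zero m (λ i → *-zeroʳ (f (suc i)))) ⟩
  f zero + 0
    ≡⟨ +-identityʳ (f zero) ⟩
  f zero
    ∎
  where open ≡-Reasoning
∑-select (suc m) f (suc k) = cong₂ _+_ (*-zeroʳ (f zero)) (begin
  ∑ m (λ i → f (suc i) * b2n ⌊ suc i Fin.≟ suc k ⌋)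
    ≡⟨ ∑-cong m (λ i → cong (λ b → f (suc i) * b2n b) (⌊⌋-map′ _ _ (i Fin.≟ k))) ⟩
  ∑ m (λ i → f (suc i) * b2n ⌊ i Fin.≟ k ⌋)
    ≡⟨ ∑-select m (λ i → f (suc i)) k ⟩
  f (suc k)
    ∎)
  where open ≡-Reasoning

∑-select-toℕ : ∀ K (f : Fin K → ℕ) {v} (v<K : v < K) →
               ∑ K (λ a → f a * b2n ⌊ v ≟ toℕ a ⌋) ≡ f (fromℕ< v<K)
∑-select-toℕ K f {v} v<K = trans (∑-cong K (λ a → cong (λ b → f a * b2n b) (same-test a)))
                                 (∑-select K f (fromℕ< v<K))
  where
  same-test : ∀ a → ⌊ v ≟ toℕ a ⌋ ≡ ⌊ a Fin.≟ fromℕ< v<K ⌋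
  same-test a = ⌊⌋-⇔
    (mk⇔ (λ v≡a → toℕ-injective (trans (sym v≡a) (sym (toℕ-fromℕ< v<K))))
         (λ a≡v → trans (sym (toℕ-fromℕ< v<K)) (cong toℕ (sym a≡v))))
    (v ≟ toℕ a) (a Fin.≟ fromℕ< v<K)

f≤pmax : ∀ n (f : Fin n → ℕ) j → f j ≤ pmax n f
f≤pmax (suc n) f zero    = m≤m⊔n (f zero) _
f≤pmax (suc n) f (suc j) = ≤-trans (f≤pmax n (λ j → f (suc j)) j) (m≤n⊔m (f zero) _)

≡⇒≡[mod] : ∀ {x y} a → x ≡ y → x ≡ y [mod a ]
≡⇒≡[mod] a x≡y = subst (ℤ.+ a ∣_) (sym (i≡j⇒i-j≡0 (cong ℤ.+_ x≡y))) (a ∣0)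

module BySize {n} (p w : Fin n → ℕ) where

  weightOfSize : ℕ → ℕ
  weightOfSize a = ∑ n (λ j → w j * b2n ⌊ p j ≟ a ⌋)

  weightOfSize-absent : ∀ a → (∀ j → p j ≢ a) → weightOfSize a ≡ 0
  weightOfSize-absent a absent = ∑-zero n (λ j →
    trans (cong (λ b → w j * b2n b) (⌊⌋-false (p j ≟ a) (absent j))) (*-zeroʳ (w j)))

  ∑-by-size : ∀ K → (∀ j → p j < K) →
              ∑ n (λ j → p j * w j) ≡ ∑ K (λ a → toℕ a * weightOfSize (toℕ a))
  ∑-by-size K p<K = begin
    ∑ n (λ j → p j * w j)
      ≡⟨ ∑-cong n (λ j → sym (select j)) ⟩
    ∑ n (λ j → ∑ K (λ a → toℕ a * w j * b2n ⌊ p j ≟ toℕ a ⌋))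
      ≡⟨ ∑-comm n K _ ⟩
    ∑ K (λ a → ∑ n (λ j → toℕ a * w j * b2n ⌊ p j ≟ toℕ a ⌋))
      ≡⟨ ∑-cong K (λ a → ∑-cong n (λ j → *-assoc (toℕ a) (w j) _)) ⟩
    ∑ K (λ a → ∑ n (λ j → toℕ a * (w j * b2n ⌊ p j ≟ toℕ a ⌋)))
      ≡⟨ ∑-cong K (λ a → *-distribˡ-∑ n (toℕ a) _) ⟨
    ∑ K (λ a → toℕ a * weightOfSize (toℕ a))
      ∎
    where
    open ≡-Reasoning
    select : ∀ j → ∑ K (λ a → toℕ a * w j * b2n ⌊ p j ≟ toℕ a ⌋) ≡ p j * w j
    select j = trans (∑-select-toℕ K (λ a → toℕ a * w j) (p<K j))
                     (cong (_* w j) (toℕ-fromℕ< (p<K j)))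

  some-size-is-heavy : ∀ {P M} → (∀ j → p j ≤ P) → 0 < P → 0 < M →
                       P * (P * M) ≤ ∑ n (λ j → p j * w j) →
                       ∃[ j ] M ≤ weightOfSize (p j)
  some-size-is-heavy {P} {M} p≤P 0<P 0<M lower with any? (λ j → M ≤? weightOfSize (p j))
  ... | yes heavy = heavy
  ... | no ¬heavy = contradiction lower (<⇒≱ (begin-strict
    ∑ n (λ j → p j * w j)                              ≡⟨ ∑-by-size (suc P) (s≤s ∘ p≤P) ⟩
    ∑ P (λ a → suc (toℕ a) * weightOfSize (suc (toℕ a))) <⟨ ∑-mono-< P 0<P term-bound ⟩
    ∑ P (λ _ → P * M)                                  ≡⟨ ∑-const P (P * M) ⟩
    P * (P * M)                                        ∎))
    where
    open ≤-Reasoning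
    -- Sizes not occurring among the p j have weight 0, so a bound on the occurring ones bounds all.
    light : ∀ a → weightOfSize a < M
    light a with any? (λ j → p j ≟ a)
    ... | yes (j , refl) = ≰⇒> (λ heavy → ¬heavy (j , heavy))
    ... | no absent = subst (_< M) (sym (weightOfSize-absent a (λ j pj≡a → absent (j , pj≡a)))) 0<M
    term-bound : ∀ (a : Fin P) → suc (toℕ a) * weightOfSize (suc (toℕ a)) < P * M
    term-bound a = <-≤-trans (*-monoʳ-< (suc (toℕ a)) (light (suc (toℕ a))))
                             (*-monoˡ-≤ M (toℕ<n a))

module Assignment {n m} (σ : Fin n → Fin m) where

  assigned : Fin m → Fin n → Bool
  assigned i j = ⌊ i Fin.≟ σ j ⌋

  ∑-assigned : ∀ j → ∑ m (λ i → b2n (assigned i j)) ≡ 1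
  ∑-assigned j = trans (∑-cong m (λ i → sym (*-identityˡ (b2n (assigned i j)))))
                       (∑-select m (λ _ → 1) (σ j))

  load : (Fin n → ℕ) → Fin m → ℕ
  load p i = ∑ n (λ j → p j * b2n (assigned i j))

  ∑-*-load : ∀ (p : Fin n → ℕ) (c : Fin m → ℕ) →
             ∑ m (λ i → c i * load p i) ≡ ∑ n (λ j → p j * c (σ j))
  ∑-*-load p c = begin
    ∑ m (λ i → c i * load p i)
      ≡⟨ ∑-cong m (λ i → *-distribˡ-∑ n (c i) _) ⟩
    ∑ m (λ i → ∑ n (λ j → c i * (p j * b2n (assigned i j))))
      ≡⟨ ∑-comm m n _ ⟩
    ∑ n (λ j → ∑ m (λ i → c i * (p j * b2n (assigned i j))))
      ≡⟨ ∑-cong n (λ j → ∑-cong m (λ i → x∙yz≈yx∙z (c i) (p j) _)) ⟩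
    ∑ n (λ j → ∑ m (λ i → p j * c i * b2n (assigned i j)))
      ≡⟨ ∑-cong n (λ j → ∑-select m (λ i → p j * c i) (σ j)) ⟩
    ∑ n (λ j → p j * c (σ j))
      ∎
    where open ≡-Reasoning

m^2*n>0⇒m>0 : ∀ m n → 0 < m ^ 2 * n → 0 < m
m^2*n>0⇒m>0 (suc m) n _ = s≤s z≤n

module FromPartition (I : MPInstance) (partition : Feasible I) where
  open MPInstance I

  σ : Fin n → Fin m
  σ = proj₁ partition

  open Assignment σ public
  open BySize p (isBig I ∘ σ) public

  load≡T : ∀ i → load p i ≡ T i
  load≡T i = trans (∑-cong n (λ j → sym (if-then-0≡*b2n (assigned i j) (p j)))) (proj₂ partition i)

  big-jobs-of-size : ∀ a →
    ∑ n (λ j → if ⌊ p j ≟ a ⌋ then ∑ m (λ i → isBig I i * b2n (assigned i j)) else 0) ≡ weightOfSize a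
  big-jobs-of-size a = ∑-cong n (λ j → trans
    (cong (λ s → if ⌊ p j ≟ a ⌋ then s else 0) (∑-select m (isBig I) (σ j)))
    (if-then-0≡*b2n ⌊ p j ≟ a ⌋ (isBig I (σ j))))

  pm⁴*isBig≤isBig*T : ∀ i → pm I ^ 4 * isBig I i ≤ isBig I i * T i
  pm⁴*isBig≤isBig*T i with T i <? pm I ^ 4
  ... | yes _  = ≤-reflexive (*-zeroʳ (pm I ^ 4))
  ... | no T≮ = begin
    pm I ^ 4 * 1 ≡⟨ *-identityʳ (pm I ^ 4) ⟩
    pm I ^ 4     ≤⟨ ≮⇒≥ T≮ ⟩
    T i          ≡⟨ +-identityʳ (T i) ⟨
    1 * T i      ∎
    where open ≤-Reasoning

  big-load : pm I * (pm I * (pm I ^ 2 * ∑ m (isBig I))) ≤ ∑ n (λ j → p j * isBig I (σ j))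
  big-load = begin
    pm I * (pm I * (pm I ^ 2 * ∑ m (isBig I))) ≡⟨ cong (pm I *_) (*-assoc (pm I) (pm I ^ 2) _) ⟨
    pm I * (pm I ^ 3 * ∑ m (isBig I))          ≡⟨ *-assoc (pm I) (pm I ^ 3) _ ⟨
    pm I ^ 4 * ∑ m (isBig I)                   ≡⟨ *-distribˡ-∑ m (pm I ^ 4) (isBig I) ⟩
    ∑ m (λ i → pm I ^ 4 * isBig I i)           ≤⟨ ∑-mono-≤ m pm⁴*isBig≤isBig*T ⟩
    ∑ m (λ i → isBig I i * T i)                ≡⟨ ∑-cong m (λ i → cong (isBig I i *_) (load≡T i)) ⟨
    ∑ m (λ i → isBig I i * load p i)           ≡⟨ ∑-*-load p (isBig I) ⟩
    ∑ n (λ j → p j * isBig I (σ j))            ∎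
    where open ≤-Reasoning

  solves-modIP : ∀ a → pm I ^ 2 * ∑ m (isBig I) ≤ weightOfSize a → ModIP I a assigned
  solves-modIP a heavy = (λ i _ → load≡T i)
                       , (λ i _ → ≡⇒≡[mod] a (load≡T i))
                       , subst (_ ≤_) (sym (big-jobs-of-size a)) heavy
                       , ∑-assigned

  heavy-size : ∃[ j ] pm I ^ 2 * ∑ m (isBig I) ≤ weightOfSize (p j)
  heavy-size with 0 <? pm I ^ 2 * ∑ m (isBig I)
  ... | no M≯0 = fromℕ< (≤-trans 1≤m m≤n) , ≤-trans (≮⇒≥ M≯0) z≤n
  ... | yes 0<M = some-size-is-heavy (f≤pmax n p) (m^2*n>0⇒m>0 (pm I) _ 0<M) 0<M big-load

lemma4 : (I : MPInstance) → Feasible I →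
    ∃[ j ] ModIPFeasible I (MPInstance.p I j)
lemma4 I partition =
  let j , heavy = heavy-size in j , assigned , solves-modIP (MPInstance.p I j) heavy
  where open FromPartition I partition
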